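{- Let $V=\{1,\ldots,v\}$, $t\ge 0$, let $\{T_0,T_1\}$ be a $[t]$-trade over $V$, and let $i\in\{1,\ldots,v\}$. Let $\{T'_0,T'_1\}$ be obtained from $\{T_0,T_1\}$ by replacing every block $(x_1,\ldots,x_v)$ by the $(v+1)$-tuple $(x_1,\ldots,x_v,x_i)$ (a subset of $\{1,\ldots,v+1\}$). Then $\{T'_0,T'_1\}$ is a $[t]$-trade over $\{1,\ldots,v+1\}$.
   Context: Subsets of an $n$-element set $\{1,\ldots,n\}$ are identified with their characteristic vectors in $\{0,1\}^n$. A $[t]$-trade over $\{1,\ldots,n\}$ is a pair $\{T_0,T_1\}$ of disjoint collections of subsets of $\{1,\ldots,n\}$ (blocks) such that for every $j\in\{0,\ldots,t\}$ and every $j$-element subset $s\subseteq\{1,\ldots,n\}$, the number of blocks of $T_0$ containing $s$ equals the number of blocks of $T_1$ containing $s$. -}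

module Defs where

open import Data.Nat using (ℕ; _≤_)
open import Data.Bool using (Bool; true; false)
open import Data.Fin using (Fin)
open import Data.Vec using (Vec; lookup; _∷ʳ_)
open import Data.List using (List; map; filter; length)
open import Data.List.Membership.Propositional using (_∈_)
open import Data.Fin.Subset using (Subset; _⊆_; ∣_∣)
open import Data.Fin.Subset.Properties using (_⊆?_)
open import Relation.Nullary using (¬_)
open import Data.Product using (_×_)

-- A block is a subset of {1,…,n}, i.e. its characteristic vector in {0,1}^n.
Block : ℕ → Set
Block n = Subset n

-- A collection of blocks (a list; multiplicities allowed).
Collection : ℕ → Set
Collection n = List (Block n)

count : ∀ {n} → Subset n → Collection n → ℕ
count s T = length (filter (s ⊆?_) T)

Disjoint : ∀ {n} → Collection n → Collection n → Set
Disjoint T₀ T₁ = ∀ B → B ∈ T₀ → ¬ (B ∈ T₁)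

IsTrade : (n t : ℕ) → Collection n → Collection n → Set
IsTrade n t T₀ T₁ =
  Disjoint T₀ T₁ ×
  (∀ (s : Subset n) → ∣ s ∣ ≤ t → count s T₀ ≡ count s T₁)
  where open import Relation.Binary.PropositionalEquality using (_≡_)

extendBlock : ∀ {v} → Fin v → Block v → Block (Data.Nat.suc v)
extendBlock i x = x ∷ʳ lookup x i

extendColl : ∀ {v} → Fin v → Collection v → Collection (Data.Nat.suc v)
extendColl i T = map (extendBlock i) T

module Submission where

-- Write a subset s of {1,…,v+1} as  p ∷ʳ b  with p ⊆ {1,…,v}
-- and b recording whether v+1 ∈ s.  The extended block  x ∷ʳ x_i  contains
-- s exactly when x contains the "shadow" of s:  p  if b is false, and
-- p ∪ {i}  if b is true (v+1 ∈ s forces x_i = 1, i.e. i ∈ x).  The shadow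
-- is never larger than s, so for |s| ≤ t the number of extended blocks of
-- T_k containing s equals the number of blocks of T_k containing the shadow,
-- and these agree for k = 0, 1 because {T₀,T₁} is a [t]-trade.
-- Disjointness survives since extending a block is injective.

open import Defs
open import Data.Nat using (ℕ; suc; _+_; _≤_; s≤s)
open import Data.Nat.Properties using (≤-refl; ≤-trans; ≤-reflexive; +-suc; +-comm; +-monoʳ-≤; n≤1+n; module ≤-Reasoning)
open import Data.Bool using (Bool; true; false)
open import Data.Fin using (Fin)
open import Data.Vec using ([]; _∷_; _∷ʳ_; lookup; initLast; here; there)
open import Data.Vec.Properties using (∷ʳ-injectiveˡ; []=⇒lookup; lookup⇒[]=)
open import Data.List using ([]; _∷_; map)
open import Data.List.Membership.Propositional.Properties using (∈-map⁻)
open import Data.Fin.Subset using (Subset; _⊆_; _∈_; _∪_; ⁅_⁆; ∣_∣)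
open import Data.Fin.Subset.Properties
  using (_⊆?_; drop-∷-⊆; p⊆p∪q; q⊆p∪q; x∈p∪q⁻; x∈⁅x⁆; x∈⁅y⁆⇒x≡y; ∣⁅x⁆∣≡1)
open import Data.Product using (_×_; _,_; proj₁; proj₂)
open import Data.Sum using ([_,_])
open import Data.Empty using (⊥-elim)
open import Function.Bundles using (_⇔_; mk⇔; Equivalence)
open import Relation.Nullary using (yes; no)
open import Relation.Binary.PropositionalEquality using (_≡_; refl; sym; trans; cong; subst; module ≡-Reasoning)

variable
  m n : ℕ

∷ʳ-⊆⁻ : (p x : Subset n) (b c : Bool) →
  p ∷ʳ b ⊆ x ∷ʳ c → p ⊆ x × (b ≡ true → c ≡ true)
∷ʳ-⊆⁻ [] [] false c h = (λ ()) , λ ()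
∷ʳ-⊆⁻ [] [] true c h with h here
... | here = (λ ()) , λ _ → refl
∷ʳ-⊆⁻ (a ∷ p) (d ∷ x) b c h = a∷p⊆d∷x , proj₂ tail
  where
  tail : p ⊆ x × (b ≡ true → c ≡ true)
  tail = ∷ʳ-⊆⁻ p x b c (drop-∷-⊆ h)
  a∷p⊆d∷x : a ∷ p ⊆ d ∷ x
  a∷p⊆d∷x here with h here
  ... | here = here
  a∷p⊆d∷x (there k) = there (proj₁ tail k)

∷ʳ-⊆⁺ : (p x : Subset n) (b c : Bool) →
  p ⊆ x → (b ≡ true → c ≡ true) → p ∷ʳ b ⊆ x ∷ʳ c
∷ʳ-⊆⁺ [] [] true c _ b⇒c here with b⇒c refl
... | refl = here
∷ʳ-⊆⁺ (a ∷ p) (d ∷ x) b c p⊆x b⇒c here with p⊆x here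
... | here = here
∷ʳ-⊆⁺ (a ∷ p) (d ∷ x) b c p⊆x b⇒c (there k) =
  there (∷ʳ-⊆⁺ p x b c (drop-∷-⊆ p⊆x) b⇒c k)

∪-⊆⇔ : (p q r : Subset n) → p ∪ q ⊆ r ⇔ (p ⊆ r × q ⊆ r)
∪-⊆⇔ p q r = mk⇔
  (λ h → (λ {_} k → h (p⊆p∪q q k)) , (λ {_} k → h (q⊆p∪q p q k)))
  (λ { (p⊆r , q⊆r) {_} k → [ p⊆r , q⊆r ] (x∈p∪q⁻ p q k) })

⁅⁆-⊆⇔ : (i : Fin n) (r : Subset n) → ⁅ i ⁆ ⊆ r ⇔ i ∈ r
⁅⁆-⊆⇔ i r = mk⇔ (λ h → h (x∈⁅x⁆ i))
                 (λ i∈r {_} k → subst (_∈ r) (sym (x∈⁅y⁆⇒x≡y i k)) i∈r)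

∣p∪q∣≤∣p∣+∣q∣ : (p q : Subset n) → ∣ p ∪ q ∣ ≤ ∣ p ∣ + ∣ q ∣
∣p∪q∣≤∣p∣+∣q∣ [] [] = ≤-refl
∣p∪q∣≤∣p∣+∣q∣ (true ∷ p) (true ∷ q) =
  s≤s (≤-trans (∣p∪q∣≤∣p∣+∣q∣ p q) (+-monoʳ-≤ ∣ p ∣ (n≤1+n ∣ q ∣)))
∣p∪q∣≤∣p∣+∣q∣ (true ∷ p) (false ∷ q) = s≤s (∣p∪q∣≤∣p∣+∣q∣ p q)
∣p∪q∣≤∣p∣+∣q∣ (false ∷ p) (true ∷ q) =
  ≤-trans (s≤s (∣p∪q∣≤∣p∣+∣q∣ p q)) (≤-reflexive (sym (+-suc ∣ p ∣ ∣ q ∣)))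
∣p∪q∣≤∣p∣+∣q∣ (false ∷ p) (false ∷ q) = ∣p∪q∣≤∣p∣+∣q∣ p q

∣p∷ʳb∣≡∣b∷p∣ : (p : Subset n) (b : Bool) → ∣ p ∷ʳ b ∣ ≡ ∣ b ∷ p ∣
∣p∷ʳb∣≡∣b∷p∣ [] b = refl
∣p∷ʳb∣≡∣b∷p∣ (true ∷ p) true = cong suc (∣p∷ʳb∣≡∣b∷p∣ p true)
∣p∷ʳb∣≡∣b∷p∣ (true ∷ p) false = cong suc (∣p∷ʳb∣≡∣b∷p∣ p false)
∣p∷ʳb∣≡∣b∷p∣ (false ∷ p) true = ∣p∷ʳb∣≡∣b∷p∣ p true
∣p∷ʳb∣≡∣b∷p∣ (false ∷ p) false = ∣p∷ʳb∣≡∣b∷p∣ p false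

count-map : (f : Block m → Block n) (s : Subset n) (s' : Subset m) →
  (∀ x → s ⊆ f x ⇔ s' ⊆ x) → (T : Collection m) →
  count s (map f T) ≡ count s' T
count-map f s s' s⇔s' [] = refl
count-map f s s' s⇔s' (x ∷ T) with s ⊆? f x | s' ⊆? x
... | yes _  | yes _   = cong suc (count-map f s s' s⇔s' T)
... | yes h  | no ¬h'  = ⊥-elim (¬h' (Equivalence.to (s⇔s' x) h))
... | no ¬h  | yes h'  = ⊥-elim (¬h (Equivalence.from (s⇔s' x) h'))
... | no _   | no _    = count-map f s s' s⇔s' T

map-Disjoint : (f : Block m → Block n) → (∀ x y → f x ≡ f y → x ≡ y) →
  (T₀ T₁ : Collection m) → Disjoint T₀ T₁ → Disjoint (map f T₀) (map f T₁)
map-Disjoint f f-inj T₀ T₁ disj B B∈₀ B∈₁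
  with ∈-map⁻ f B∈₀ | ∈-map⁻ f B∈₁
... | x , x∈T₀ , B≡fx | y , y∈T₁ , B≡fy
  with f-inj x y (trans (sym B≡fx) B≡fy)
... | refl = disj x x∈T₀ y∈T₁

extendBlock-injective : (i : Fin n) (x y : Block n) →
  extendBlock i x ≡ extendBlock i y → x ≡ y
extendBlock-injective i x y = ∷ʳ-injectiveˡ x y

-- The shadow of the subset p ∷ʳ b of {1,…,n+1}: the subset of {1,…,n}
-- which a block must contain for its extension to contain p ∷ʳ b.
shadow : Fin n → Subset n → Bool → Subset n
shadow i p false = p
shadow i p true  = p ∪ ⁅ i ⁆

shadow-⊆⇔ : (i : Fin n) (p : Subset n) (b : Bool) (x : Block n) →
  p ∷ʳ b ⊆ extendBlock i x ⇔ shadow i p b ⊆ x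
shadow-⊆⇔ i p b x = mk⇔ (to b) (from b)
  where
  to : (b : Bool) → p ∷ʳ b ⊆ extendBlock i x → shadow i p b ⊆ x
  to false h = proj₁ (∷ʳ-⊆⁻ p x false (lookup x i) h)
  to true h = Equivalence.from (∪-⊆⇔ p ⁅ i ⁆ x)
    (p⊆x , Equivalence.from (⁅⁆-⊆⇔ i x) (lookup⇒[]= i x xᵢ≡true))
    where
    p⊆x : p ⊆ x
    p⊆x = proj₁ (∷ʳ-⊆⁻ p x true (lookup x i) h)
    xᵢ≡true : lookup x i ≡ true
    xᵢ≡true = proj₂ (∷ʳ-⊆⁻ p x true (lookup x i) h) refl

  from : (b : Bool) → shadow i p b ⊆ x → p ∷ʳ b ⊆ extendBlock i x
  from false p⊆x = ∷ʳ-⊆⁺ p x false (lookup x i) p⊆x (λ ())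
  from true h = ∷ʳ-⊆⁺ p x true (lookup x i) p⊆x
    (λ _ → []=⇒lookup (Equivalence.to (⁅⁆-⊆⇔ i x) ⁅i⁆⊆x))
    where
    p⊆x : p ⊆ x
    p⊆x = proj₁ (Equivalence.to (∪-⊆⇔ p ⁅ i ⁆ x) h)
    ⁅i⁆⊆x : ⁅ i ⁆ ⊆ x
    ⁅i⁆⊆x = proj₂ (Equivalence.to (∪-⊆⇔ p ⁅ i ⁆ x) h)

∣shadow∣≤ : (i : Fin n) (p : Subset n) (b : Bool) → ∣ shadow i p b ∣ ≤ ∣ p ∷ʳ b ∣
∣shadow∣≤ i p false = ≤-reflexive (sym (∣p∷ʳb∣≡∣b∷p∣ p false))
∣shadow∣≤ i p true = begin
  ∣ p ∪ ⁅ i ⁆ ∣       ≤⟨ ∣p∪q∣≤∣p∣+∣q∣ p ⁅ i ⁆ ⟩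
  ∣ p ∣ + ∣ ⁅ i ⁆ ∣   ≡⟨ cong (∣ p ∣ +_) (∣⁅x⁆∣≡1 i) ⟩
  ∣ p ∣ + 1           ≡⟨ +-comm ∣ p ∣ 1 ⟩
  ∣ true ∷ p ∣        ≡⟨ sym (∣p∷ʳb∣≡∣b∷p∣ p true) ⟩
  ∣ p ∷ʳ true ∣       ∎
  where open ≤-Reasoning

lemma2 : (v t : ℕ) (i : Fin v) (T₀ T₁ : Collection v) →
    IsTrade v t T₀ T₁ →
    IsTrade (suc v) t (extendColl i T₀) (extendColl i T₁)
lemma2 v t i T₀ T₁ (disj , balanced) =
  map-Disjoint (extendBlock i) (extendBlock-injective i) T₀ T₁ disj , balanced′
  where
  balanced′ : ∀ (s : Subset (suc v)) → ∣ s ∣ ≤ t →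
    count s (extendColl i T₀) ≡ count s (extendColl i T₁)
  balanced′ s ∣s∣≤t with initLast s
  ... | p , b , refl = begin
    count (p ∷ʳ b) (extendColl i T₀)  ≡⟨ count-map (extendBlock i) _ _ (shadow-⊆⇔ i p b) T₀ ⟩
    count (shadow i p b) T₀           ≡⟨ balanced (shadow i p b) (≤-trans (∣shadow∣≤ i p b) ∣s∣≤t) ⟩
    count (shadow i p b) T₁           ≡⟨ count-map (extendBlock i) _ _ (shadow-⊆⇔ i p b) T₁ ⟨
    count (p ∷ʳ b) (extendColl i T₁)  ∎
    where open ≡-Reasoning
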